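{- Let $\alpha\in\mathcal{NCP}(n)$. The set of $\beta\in\mathcal{NCP}(n)$ such that $(\alpha,\beta)$ is admissible, ordered by refinement, is closed under meets and joins of $\mathcal{NCP}(n)$, and hence forms a sublattice of $\mathcal{NCP}(n)$.
   Context: A partition of $[m]=\{1,\dots,m\}$ is noncrossing if there are no two distinct blocks $B,C$ and $a<b<c<d$ with $a,c\in B$, $b,d\in C$. $\mathcal{NCP}(m)$ is the lattice of noncrossing partitions of $[m]$ under refinement ($\pi\mid\mu$ iff each block of $\pi$ lies in a block of $\mu$). For $\alpha,\beta\in\mathcal{NCP}(n)$, $\alpha\ast_n\beta$ is the partition of $[2n]$ with blocks $\{2x-1:x\in B\}$ ($B$ a block of $\alpha$) and $\{2x:x\in C\}$ ($C$ a block of $\beta$); the pair $(\alpha,\beta)$ is admissible if $\alpha\ast_n\beta$ is noncrossing. -}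

module Defs where

open import Data.Nat using (ℕ; suc; _*_; _<_; _≡ᵇ_; _/_; _%_)
open import Data.Bool using (if_then_else_)
open import Data.Product using (_×_)
open import Relation.Binary.PropositionalEquality using (_≡_)

-- A set partition of [m] is represented by a block-labelling:
-- positions 0,1,…,m-1 (0-based; position i stands for i+1 ∈ [m])
-- are in the same block iff they carry the same label.
-- Values at positions ≥ m are irrelevant.
Partition : Set
Partition = ℕ → ℕ

SameBlock : Partition → ℕ → ℕ → Set
SameBlock π i j = π i ≡ π j

Refines : ℕ → Partition → Partition → Set
Refines m π μ = ∀ i j → i < m → j < m → SameBlock π i j → SameBlock μ i j

NonCrossing : ℕ → Partition → Set
NonCrossing m π = ∀ a b c d → a < b → b < c → c < d → d < m →
  SameBlock π a c → SameBlock π b d → SameBlock π a b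

-- α ∗ β on [2n]: (0-based) even position 2k carries α's block of k,
-- odd position 2k+1 carries β's block of k.  Labels are made disjoint
-- (even labels for α, odd labels for β).
star : Partition → Partition → Partition
star α β i = if i % 2 ≡ᵇ 0 then 2 * α (i / 2) else suc (2 * β (i / 2))

Admissible : ℕ → Partition → Partition → Set
Admissible n α β = NonCrossing (2 * n) (star α β)

IsMeetNC : ℕ → Partition → Partition → Partition → Set
IsMeetNC n β₁ β₂ γ =
  NonCrossing n γ × Refines n γ β₁ × Refines n γ β₂ ×
  (∀ δ → NonCrossing n δ → Refines n δ β₁ → Refines n δ β₂ → Refines n δ γ)

IsJoinNC : ℕ → Partition → Partition → Partition → Set
IsJoinNC n β₁ β₂ γ =
  NonCrossing n γ × Refines n β₁ γ × Refines n β₂ γ ×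
  (∀ δ → NonCrossing n δ → Refines n β₁ δ → Refines n β₂ δ → Refines n γ δ)

{-# OPTIONS --safe #-}
module Submission where

-- For noncrossing α and β, α ∗ β is noncrossing
-- exactly when no block of β straddles an arc of α: for all x, y in one
-- block of α, β refines the two-block partition {[x, y), complement}.
-- Such a two-block partition is itself noncrossing, so this condition passes
-- to every partition finer than β (hence to meets) and, by the universal
-- property of the join in NCP(n), to joins.

open import Defs
open import Data.Bool using (if_then_else_)
open import Data.Nat using (ℕ; suc; _*_; _/_; _≤_; _<_; s≤s; s≤s⁻¹; s<s⁻¹; _≤?_; _<?_)
open import Data.Nat.Properties
open import Data.Nat.DivMod using (m*n/n≡m; /-congˡ; %-remove-+ʳ; +-distrib-/-∣ʳ)
open import Data.Nat.Divisibility using (m∣m*n; n∣m⇒m%n≡0)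
open import Data.Product using (_×_; _,_; proj₁; proj₂)
open import Function using (_∘_)
open import Level using (0ℓ)
open import Relation.Nullary using (yes; no; contradiction)
open import Relation.Nullary.Decidable using (does; _×-dec_)
open import Relation.Unary using (Pred; Decidable; _∈_)
open import Relation.Binary.PropositionalEquality
open ≡-Reasoning

Refines-trans : ∀ {m π μ ν} → Refines m π μ → Refines m μ ν → Refines m π ν
Refines-trans π≤μ μ≤ν i j i<m j<m = μ≤ν i j i<m j<m ∘ π≤μ i j i<m j<m

indicator : {P : Pred ℕ 0ℓ} → Decidable P → Partition
indicator P? i = if does (P? i) then 0 else 1

module _ {P : Pred ℕ 0ℓ} (P? : Decidable P) where

  indicator-≡⁻ : ∀ {i j} → SameBlock (indicator P?) i j → P i → P j
  indicator-≡⁻ {i} {j} eq pᵢ with P? i | P? j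
  ... | _      | yes pⱼ = pⱼ
  ... | yes _  | no _   = contradiction eq 0≢1+n
  ... | no ¬pᵢ | no _   = contradiction pᵢ ¬pᵢ

  indicator-≡⁺ : ∀ {i j} → (P i → P j) → (P j → P i) → SameBlock (indicator P?) i j
  indicator-≡⁺ {i} {j} to from with P? i | P? j
  ... | yes _  | yes _  = refl
  ... | no _   | no _   = refl
  ... | yes pᵢ | no ¬pⱼ = contradiction (to pᵢ) ¬pⱼ
  ... | no ¬pᵢ | yes pⱼ = contradiction (from pⱼ) ¬pᵢ

Convex : Pred ℕ 0ℓ → Set
Convex P = ∀ {a b c} → a ≤ b → b ≤ c → P a → P c → P b

indicator-noncrossing : ∀ {P} (P? : Decidable P) → Convex P → ∀ m → NonCrossing m (indicator P?)
indicator-noncrossing {P} P? convex m a b c d a<b b<c c<d _ ac bd = indicator-≡⁺ P? a⇒b b⇒a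
  where
  a⇒b : P a → P b
  a⇒b pa = convex (<⇒≤ a<b) (<⇒≤ b<c) pa (indicator-≡⁻ P? ac pa)
  b⇒a : P b → P a
  b⇒a pb = indicator-≡⁻ P? (sym ac) (convex (<⇒≤ b<c) (<⇒≤ c<d) pb (indicator-≡⁻ P? bd pb))

[_,_⟩ : ℕ → ℕ → Pred ℕ 0ℓ
[ x , y ⟩ i = x ≤ i × i < y

[_,_⟩? : ∀ x y → Decidable [ x , y ⟩
[ x , y ⟩? i = x ≤? i ×-dec i <? y

[,⟩-convex : ∀ x y → Convex [ x , y ⟩
[,⟩-convex x y a≤b b≤c (x≤a , _) (_ , c<y) = ≤-trans x≤a a≤b , ≤-<-trans b≤c c<y

Compatible : ℕ → Partition → Partition → Set
Compatible n α β = ∀ x y → y < n → SameBlock α x y → Refines n β (indicator [ x , y ⟩?)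

Compatible⇒∈-closed : ∀ {n α β} → Compatible n α β → ∀ {x y i j} → y < n → SameBlock α x y →
  i < n → j < n → SameBlock β i j → i ∈ [ x , y ⟩ → j ∈ [ x , y ⟩
Compatible⇒∈-closed compat {x} {y} {i} {j} y<n αxy i<n j<n βij =
  indicator-≡⁻ [ x , y ⟩? (compat x y y<n αxy i j i<n j<n βij)

Compatible-antitone : ∀ {n α β γ} → Refines n γ β → Compatible n α β → Compatible n α γ
Compatible-antitone γ≤β compat x y y<n αxy = Refines-trans γ≤β (compat x y y<n αxy)

Compatible-join : ∀ {n α β₁ β₂ γ} → Compatible n α β₁ → Compatible n α β₂ →
  IsJoinNC n β₁ β₂ γ → Compatible n α γ
Compatible-join {n} compat₁ compat₂ (_ , _ , _ , least) x y y<n αxy =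
  least (indicator [ x , y ⟩?) (indicator-noncrossing [ x , y ⟩? ([,⟩-convex x y) n)
    (compat₁ x y y<n αxy) (compat₂ x y y<n αxy)

data EvenOdd : ℕ → Set where
  even : ∀ k → EvenOdd (2 * k)
  odd  : ∀ k → EvenOdd (suc (2 * k))

evenOdd : ∀ i → EvenOdd i
evenOdd 0 = even 0
evenOdd (suc i) with evenOdd i
... | even k = odd k
... | odd k  = subst EvenOdd (*-suc 2 k) (even (suc k))

[2*k]/2≡k : ∀ k → 2 * k / 2 ≡ k
[2*k]/2≡k k = trans (/-congˡ (*-comm 2 k)) (m*n/n≡m k 2)

star-even : ∀ α β k → star α β (2 * k) ≡ 2 * α k
star-even α β k rewrite n∣m⇒m%n≡0 (2 * k) 2 (m∣m*n {2} k) | [2*k]/2≡k k = refl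

star-odd : ∀ α β k → star α β (suc (2 * k)) ≡ suc (2 * β k)
star-odd α β k
  rewrite %-remove-+ʳ 1 (m∣m*n {2} k) | +-distrib-/-∣ʳ 1 (m∣m*n {2} k) | [2*k]/2≡k k = refl

star-even≢odd : ∀ α β i j → star α β (2 * i) ≢ star α β (suc (2 * j))
star-even≢odd α β i j eq = even≢odd (α i) (β j) (begin
  2 * α i                  ≡⟨ star-even α β i ⟨
  star α β (2 * i)         ≡⟨ eq ⟩
  star α β (suc (2 * j))   ≡⟨ star-odd α β j ⟩
  suc (2 * β j)            ∎)

data StarPair (α β : Partition) : ℕ → ℕ → Set where
  evens : ∀ i k → SameBlock α i k → StarPair α β (2 * i) (2 * k)
  odds  : ∀ i k → SameBlock β i k → StarPair α β (suc (2 * i)) (suc (2 * k))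

StarPair⇒SameBlock : ∀ α β {a c} → StarPair α β a c → SameBlock (star α β) a c
StarPair⇒SameBlock α β (evens i k αik) = begin
  star α β (2 * i)   ≡⟨ star-even α β i ⟩
  2 * α i            ≡⟨ cong (2 *_) αik ⟩
  2 * α k            ≡⟨ star-even α β k ⟨
  star α β (2 * k)   ∎
StarPair⇒SameBlock α β (odds i k βik) = begin
  star α β (suc (2 * i))   ≡⟨ star-odd α β i ⟩
  suc (2 * β i)            ≡⟨ cong (suc ∘ (2 *_)) βik ⟩
  suc (2 * β k)            ≡⟨ star-odd α β k ⟨
  star α β (suc (2 * k))   ∎

SameBlock⇒StarPair : ∀ α β a c → SameBlock (star α β) a c → StarPair α β a c
SameBlock⇒StarPair α β a c eq with evenOdd a | evenOdd c
... | even i | even k = evens i k (*-cancelˡ-≡ (α i) (α k) 2 (begin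
  2 * α i            ≡⟨ star-even α β i ⟨
  star α β (2 * i)   ≡⟨ eq ⟩
  star α β (2 * k)   ≡⟨ star-even α β k ⟩
  2 * α k            ∎))
... | odd i  | odd k  = odds i k (*-cancelˡ-≡ (β i) (β k) 2 (suc-injective (begin
  suc (2 * β i)            ≡⟨ star-odd α β i ⟨
  star α β (suc (2 * i))   ≡⟨ eq ⟩
  star α β (suc (2 * k))   ≡⟨ star-odd α β k ⟩
  suc (2 * β k)            ∎)))
... | even i | odd k  = contradiction eq (star-even≢odd α β i k)
... | odd i  | even k = contradiction (sym eq) (star-even≢odd α β k i)

module _ {i j : ℕ} where

  ≤⇒even<odd : i ≤ j → 2 * i < suc (2 * j)
  ≤⇒even<odd = s≤s ∘ *-monoʳ-≤ 2

  <⇒odd<even : i < j → suc (2 * i) < 2 * j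
  <⇒odd<even i<j = subst (_≤ 2 * j) (*-suc 2 i) (*-monoʳ-≤ 2 i<j)

  even<even⇒< : 2 * i < 2 * j → i < j
  even<even⇒< = *-cancelˡ-< 2 i j

  odd<odd⇒< : suc (2 * i) < suc (2 * j) → i < j
  odd<odd⇒< = even<even⇒< ∘ s<s⁻¹

  even<odd⇒≤ : 2 * i < suc (2 * j) → i ≤ j
  even<odd⇒≤ = *-cancelˡ-≤ 2 ∘ s≤s⁻¹

  odd<even⇒< : suc (2 * i) < 2 * j → i < j
  odd<even⇒< = even<even⇒< ∘ <-trans (n<1+n (2 * i))

admissible⇒compatible : ∀ {n α β} → Admissible n α β → Compatible n α β
admissible⇒compatible {n} {α} {β} adm x y y<n αxy i j i<n j<n βij =
  indicator-≡⁺ [ x , y ⟩? (stays j<n βij) (stays i<n (sym βij))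
  where
  stays : ∀ {i j} → j < n → SameBlock β i j → i ∈ [ x , y ⟩ → j ∈ [ x , y ⟩
  stays {i} {j} j<n βij (x≤i , i<y) with j <? x | y ≤? j
  ... | yes j<x | _ = contradiction
    (adm (suc (2 * j)) (2 * x) (suc (2 * i)) (2 * y)
      (<⇒odd<even j<x) (≤⇒even<odd x≤i) (<⇒odd<even i<y) (*-monoʳ-< 2 y<n)
      (StarPair⇒SameBlock α β (odds j i (sym βij))) (StarPair⇒SameBlock α β (evens x y αxy)))
    (star-even≢odd α β x j ∘ sym)
  ... | no _ | yes y≤j = contradiction
    (adm (2 * x) (suc (2 * i)) (2 * y) (suc (2 * j))
      (≤⇒even<odd x≤i) (<⇒odd<even i<y) (≤⇒even<odd y≤j) (<⇒odd<even j<n)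
      (StarPair⇒SameBlock α β (evens x y αxy)) (StarPair⇒SameBlock α β (odds i j βij)))
    (star-even≢odd α β x i)
  ... | no j≮x | no y≰j = ≮⇒≥ j≮x , ≰⇒> y≰j

compatible⇒admissible : ∀ {n α β} → NonCrossing n α → NonCrossing n β → Compatible n α β →
  Admissible n α β
compatible⇒admissible {n} {α} {β} ncα ncβ compat a b c d a<b b<c c<d d<2n ac bd
  with SameBlock⇒StarPair α β a c ac | SameBlock⇒StarPair α β b d bd
... | evens i k αik | evens j l αjl = StarPair⇒SameBlock α β (evens i j
  (ncα i j k l (even<even⇒< a<b) (even<even⇒< b<c) (even<even⇒< c<d) (even<even⇒< d<2n) αik αjl))
... | odds i k βik | odds j l βjl = StarPair⇒SameBlock α β (odds i j
  (ncβ i j k l (odd<odd⇒< a<b) (odd<odd⇒< b<c) (odd<odd⇒< c<d) (odd<even⇒< d<2n) βik βjl))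
... | evens i k αik | odds j l βjl =
  contradiction (proj₂ (Compatible⇒∈-closed compat k<n αik j<n l<n βjl (i≤j , j<k))) (≤⇒≯ k≤l)
  where
  i≤j : i ≤ j
  i≤j = even<odd⇒≤ a<b
  j<k : j < k
  j<k = odd<even⇒< b<c
  k≤l : k ≤ l
  k≤l = even<odd⇒≤ c<d
  l<n : l < n
  l<n = odd<even⇒< d<2n
  k<n : k < n
  k<n = ≤-<-trans k≤l l<n
  j<n : j < n
  j<n = <-trans j<k k<n
... | odds i k βik | evens j l αjl =
  contradiction (proj₁ (Compatible⇒∈-closed compat l<n αjl k<n i<n (sym βik) (j≤k , k<l))) (<⇒≱ i<j)
  where
  i<j : i < j
  i<j = odd<even⇒< a<b
  j≤k : j ≤ k
  j≤k = even<odd⇒≤ b<c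
  k<l : k < l
  k<l = odd<even⇒< c<d
  l<n : l < n
  l<n = even<even⇒< d<2n
  k<n : k < n
  k<n = <-trans k<l l<n
  i<n : i < n
  i<n = <-trans i<j (≤-<-trans j≤k k<n)

lemma3p14 : (n : ℕ) (α β₁ β₂ : Partition) →
    NonCrossing n α → NonCrossing n β₁ → NonCrossing n β₂ →
    Admissible n α β₁ → Admissible n α β₂ →
    ((γ : Partition) → IsMeetNC n β₁ β₂ γ → Admissible n α γ) ×
    ((γ : Partition) → IsJoinNC n β₁ β₂ γ → Admissible n α γ)
lemma3p14 n α β₁ β₂ ncα _ _ adm₁ adm₂ = meet-admissible , join-admissible
  where
  compatible₁ : Compatible n α β₁
  compatible₁ = admissible⇒compatible adm₁

  compatible₂ : Compatible n α β₂
  compatible₂ = admissible⇒compatible adm₂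

  meet-admissible : (γ : Partition) → IsMeetNC n β₁ β₂ γ → Admissible n α γ
  meet-admissible γ (ncγ , γ≤β₁ , _) =
    compatible⇒admissible ncα ncγ (Compatible-antitone γ≤β₁ compatible₁)

  join-admissible : (γ : Partition) → IsJoinNC n β₁ β₂ γ → Admissible n α γ
  join-admissible γ join@(ncγ , _) =
    compatible⇒admissible ncα ncγ (Compatible-join compatible₁ compatible₂ join)
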